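{- Let $p,q\ge 2$ be integers, let $F$ be the graph obtained by removing one edge from $K_{p,q}$, and let $G$ be a finite simple bipartite graph. Then \[ \hom(F,G)\ \ge\ \hom(K_{p,q},G)+\eta_{p,q}(G)\ \ge\ \hom(K_{p,q},G). \] Furthermore: (1) $\hom(F,G)=\hom(K_{p,q},G)$ if and only if $\eta_{p,q}(G)=0$ (equivalently, $\mathcal{D}=\emptyset$); (2) if $p=2$ or $q=2$, then $\hom(F,G)=\hom(K_{p,q},G)+\eta_{p,q}(G)$.
   Context: $\hom(F,G)$ is the number of maps $\phi:V(F)\to V(G)$ sending every edge of $F$ to an edge of $G$. $K_{p,q}$ is the complete bipartite graph with partite sets of sizes $p$ and $q$. $\mathcal{N}_G(x)$ denotes the set of neighbours of $x$ in $G$. Define $\mathcal{D}=\{(u,v)\in V(G)\times V(G):\ \{u,v\}\notin E(G),\ \exists\, w\in\mathcal{N}_G(u)\text{ with }\mathcal{N}_G(v)\cap\mathcal{N}_G(w)\ne\emptyset\}$ and \[ \eta_{p,q}(G)=\sum_{(u,v)\in\mathcal{D}}\ \sum_{w\in\mathcal{N}_G(u):\ \mathcal{N}_G(v)\cap\mathcal{N}_G(w)\neq\emptyset}|\mathcal{N}_G(v)\cap\mathcal{N}_G(w)|^{\max\{p,q\}-1}. \] -}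

module Defs where

open import Data.Nat using (ℕ; zero; suc; _+_; _^_; _∸_; _⊔_; _<ᵇ_; _≡ᵇ_)
open import Data.Bool using (Bool; true; false; _∧_; _∨_; not; if_then_else_; _xor_)
open import Data.Bool.Properties using (∧-comm; ∨-comm)
open import Data.Fin using (Fin; toℕ)
open import Data.List using (List; []; _∷_; map; concatMap; length; filter)
open import Data.Nat.ListAction using (sum)
open import Data.Bool.ListAction using (and)
open import Data.List.Base using (allFin)
open import Data.Vec.Functional as VF using ()
open import Data.Product using (Σ; ∃; _×_)
open import Relation.Binary.PropositionalEquality using (_≡_; _≢_; refl; cong; cong₂)
open import Relation.Nullary using (¬_)

record Graph : Set where
  field
    n     : ℕ
    adj   : Fin n → Fin n → Bool
    sym   : ∀ u v → adj u v ≡ adj v u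
    irrefl : ∀ u → adj u u ≡ false
open Graph public

Bipartite : Graph → Set
Bipartite G = Σ (Fin (n G) → Bool) λ c → ∀ u v → adj G u v ≡ true → c u ≢ c v

sumFin : (k : ℕ) → (Fin k → ℕ) → ℕ
sumFin k f = sum (map f (allFin k))

allFuns : (m k : ℕ) → List (Fin m → Fin k)
allFuns zero    k = (λ ()) ∷ []
allFuns (suc m) k = concatMap (λ f → map (λ x → x VF.∷ f) (allFin k)) (allFuns m k)

allB : (k : ℕ) → (Fin k → Bool) → Bool
allB k P = and (map P (allFin k))

isHomB : (F G : Graph) → (Fin (n F) → Fin (n G)) → Bool
isHomB F G φ = allB (n F) λ i → allB (n F) λ j →
  not (adj F i j) ∨ adj G (φ i) (φ j)

hom : Graph → Graph → ℕ
hom F G = length (filter (λ φ → Data.Bool._≟_ (isHomB F G φ) true) (allFuns (n F) (n G)))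
  where import Data.Bool

-- complete bipartite graph K_{p,q}: vertices 0..p-1 form one side, p..p+q-1 the other
KAdj : (p q : ℕ) → Fin (p + q) → Fin (p + q) → Bool
KAdj p q i j = (toℕ i <ᵇ p) xor (toℕ j <ᵇ p)

xor-sym : ∀ a b → a xor b ≡ b xor a
xor-sym false false = refl
xor-sym false true  = refl
xor-sym true  false = refl
xor-sym true  true  = refl

xor-self : ∀ a → a xor a ≡ false
xor-self false = refl
xor-self true  = refl

K : ℕ → ℕ → Graph
K p q = record
  { n = p + q
  ; adj = KAdj p q
  ; sym = λ u v → xor-sym (toℕ u <ᵇ p) (toℕ v <ᵇ p)
  ; irrefl = λ u → xor-self (toℕ u <ᵇ p)
  }

isPair : ∀ {k} → ℕ → ℕ → Fin k → Fin k → Bool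
isPair a b u v = ((toℕ u ≡ᵇ a) ∧ (toℕ v ≡ᵇ b)) ∨ ((toℕ u ≡ᵇ b) ∧ (toℕ v ≡ᵇ a))

isPair-sym : ∀ {k} a b (u v : Fin k) → isPair a b u v ≡ isPair a b v u
isPair-sym a b u v
  rewrite ∧-comm (toℕ u ≡ᵇ a) (toℕ v ≡ᵇ b) | ∧-comm (toℕ u ≡ᵇ b) (toℕ v ≡ᵇ a)
  = ∨-comm ((toℕ v ≡ᵇ b) ∧ (toℕ u ≡ᵇ a)) ((toℕ v ≡ᵇ a) ∧ (toℕ u ≡ᵇ b))

removeEdge : Graph → ℕ → ℕ → Graph
removeEdge G a b = record
  { n = n G
  ; adj = λ u v → adj G u v ∧ not (isPair a b u v)
  ; sym = λ u v → cong₂ _∧_ (Graph.sym G u v) (cong not (isPair-sym a b u v))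
  ; irrefl = λ u → cong (_∧ not (isPair a b u u)) (irrefl G u)
  }

-- K_{p,q} minus one edge: the edge between vertex 0 (first side) and vertex p
-- (second side); all edges of K_{p,q} are equivalent under automorphisms.
Kminus : ℕ → ℕ → Graph
Kminus p q = removeEdge (K p q) 0 p

codeg : (G : Graph) → Fin (n G) → Fin (n G) → ℕ
codeg G v w = sumFin (n G) λ x → if adj G v x ∧ adj G w x then 1 else 0

InD : (G : Graph) → Fin (n G) → Fin (n G) → Set
InD G u v = (adj G u v ≡ false) ×
  ∃ λ w → (adj G u w ≡ true) × (¬ codeg G v w ≡ 0)

-- η_{p,q}(G); the inner sum is empty unless the existential part of D holds,
-- so summing over non-adjacent pairs (u,v) equals summing over D.
eta : ℕ → ℕ → Graph → ℕ
eta p q G = sumFin (n G) λ u → sumFin (n G) λ v →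
  if adj G u v then 0 else
  (sumFin (n G) λ w →
     if adj G u w ∧ not (codeg G v w ≡ᵇ 0) then codeg G v w ^ ((p ⊔ q) ∸ 1) else 0)

{-# OPTIONS --safe #-}
-- Write p = 1 + a, q = 1 + b and split a map φ : V(K_{p,q}) → V(G) into the images u, v of the
-- ends of the removed edge and the images x, y of the other a + b vertices. Then φ is a
-- homomorphism of F but not of K_{p,q} exactly when u ≁ v, x ⊆ N(v), y ⊆ N(u) and every x_i is
-- adjacent to every y_j; so hom(F,G) − hom(K_{p,q},G) counts such bicliques (x, y) over all
-- non-adjacent pairs (u,v). For fixed x ⊆ N(v) there are c^b choices of y, where c is the number
-- of common neighbours of u and x; keeping only the constant x = (z,…,z) gives the lower bound
-- Σ_{z ∼ v} codeg(u,z)^b, which is exact when a = 1. Exchanging the roles of the two sides gives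
-- the exponent a instead, so the exponent max(a,b) of η_{p,q} is available. Finally, a biclique
-- at a non-adjacent pair (u,v) witnesses (u,v) ∈ D, which yields the characterisation of equality.
module Submission where

open import Defs hiding (sym)
open import Data.Bool using (Bool; true; false; _∧_; _∨_; not; if_then_else_; _xor_)
open import Data.Bool.ListAction using (and)
open import Data.Bool.Properties using (⇔→≡; ∨-identityʳ; T-≡)
open import Data.Empty using (⊥)
open import Data.Fin using (Fin; zero; suc; toℕ; splitAt; join; _↑ˡ_; _↑ʳ_)
open import Data.Fin.Properties using (join-splitAt; toℕ-↑ˡ; toℕ-↑ʳ; toℕ<n)
open import Data.List using (List; []; _∷_; _++_; map; concatMap; length; filter; allFin)
open import Data.List.Membership.Propositional using (_∈_)
open import Data.List.Membership.Propositional.Properties using (∈-allFin)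
open import Data.List.Properties using (map-cong; map-++; map-∘; map-tabulate)
open import Data.List.Relation.Unary.Any using (here; there)
open import Data.Nat
  using (ℕ; zero; suc; _+_; _*_; _^_; _∸_; _⊔_; _≤_; _<_; _≥_; z≤n; s≤s; _<ᵇ_; _≡ᵇ_)
open import Data.Nat.ListAction using (sum)
open import Data.Nat.ListAction.Properties using (sum-++)
open import Data.Nat.Properties
open import Algebra.Properties.CommutativeSemigroup +-commutativeSemigroup using (interchange)
open import Data.Product using (_×_; _,_; proj₁; proj₂)
open import Data.Sum using (_⊎_; inj₁; inj₂)
import Data.Vec.Functional as VF
open import Data.Vec.Functional.Properties using (lookup-++ˡ; lookup-++ʳ)
open import Function.Base using (_∘_; id; const)
open import Function.Bundles using (_⇔_; mk⇔; module Equivalence)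
open import Function.Properties.Equivalence using () renaming (trans to ⇔-trans; sym to ⇔-sym)
open import Relation.Binary.PropositionalEquality
open import Relation.Nullary using (¬_; contradiction)

open Equivalence using (to; from)

private variable
  A B : Set

⟦_⟧ : Bool → ℕ
⟦ b ⟧ = if b then 1 else 0

∧≡true⇔ : ∀ {a b} → a ∧ b ≡ true ⇔ (a ≡ true × b ≡ true)
∧≡true⇔ {true}  = mk⇔ (refl ,_) proj₂
∧≡true⇔ {false} = mk⇔ (λ ()) (λ { (() , _) })

not-∨≡true⇔ : ∀ {a b} → not a ∨ b ≡ true ⇔ (a ≡ true → b ≡ true)
not-∨≡true⇔ {true}  = mk⇔ (λ b≡true _ → b≡true) (λ h → h refl)
not-∨≡true⇔ {false} = mk⇔ (λ _ ()) (λ _ → refl)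

⟦∧⟧ : ∀ a b → ⟦ a ∧ b ⟧ ≡ ⟦ a ⟧ * ⟦ b ⟧
⟦∧⟧ false b = refl
⟦∧⟧ true  b = sym (+-identityʳ ⟦ b ⟧)

⟦⟧≡0 : ∀ {b} → ¬ b ≡ true → ⟦ b ⟧ ≡ 0
⟦⟧≡0 {false} _     = refl
⟦⟧≡0 {true}  b≢true = contradiction refl b≢true

allB-suc : ∀ k (P : Fin (suc k) → Bool) → allB (suc k) P ≡ P zero ∧ allB k (P ∘ suc)
allB-suc k P = cong (λ bs → P zero ∧ and bs)
                    (trans (map-tabulate suc P) (sym (map-tabulate id (P ∘ suc))))

allB≡true⇔ : ∀ k {P : Fin k → Bool} → allB k P ≡ true ⇔ (∀ i → P i ≡ true)
allB≡true⇔ zero            = mk⇔ (λ _ ()) (λ _ → refl)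
allB≡true⇔ (suc k) {P} rewrite allB-suc k P = mk⇔
  (λ h → let (h₀ , hₛ) = to ∧≡true⇔ h in
         λ { zero → h₀ ; (suc i) → to (allB≡true⇔ k) hₛ i })
  (λ h → from ∧≡true⇔ (h zero , from (allB≡true⇔ k) (h ∘ suc)))

allB-cong : ∀ k {P Q : Fin k → Bool} → P ≗ Q → allB k P ≡ allB k Q
allB-cong k P≗Q = cong and (map-cong P≗Q (allFin k))

allB-const : ∀ k b → allB (suc k) (const b) ≡ b
allB-const k b = ⇔→≡ (mk⇔ (λ h → to (allB≡true⇔ (suc k)) h zero)
                          (λ h → from (allB≡true⇔ (suc k)) (λ _ → h)))

∑ : List A → (A → ℕ) → ℕ
∑ L f = sum (map f L)

infix 5 ∑
syntax ∑ L (λ x → e) = ∑[ x ∈ L ] e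

∑-cong : (L : List A) {f g : A → ℕ} → f ≗ g → ∑ L f ≡ ∑ L g
∑-cong L f≗g = cong sum (map-cong f≗g L)

∑-mono : (L : List A) {f g : A → ℕ} → (∀ x → f x ≤ g x) → ∑ L f ≤ ∑ L g
∑-mono []       f≤g = z≤n
∑-mono (x ∷ xs) f≤g = +-mono-≤ (f≤g x) (∑-mono xs f≤g)

∑-zero : (L : List A) {f : A → ℕ} → (∀ x → f x ≡ 0) → ∑ L f ≡ 0
∑-zero []       f≡0 = refl
∑-zero (x ∷ xs) f≡0 = cong₂ _+_ (f≡0 x) (∑-zero xs f≡0)

∑-term : {L : List A} (f : A → ℕ) {x : A} → x ∈ L → f x ≤ ∑ L f
∑-term f (here refl) = m≤m+n _ _
∑-term f (there x∈) = ≤-trans (∑-term f x∈) (m≤n+m _ _)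

∑-if : (L : List A) (c : Bool) (f : A → ℕ) →
  ∑[ x ∈ L ] (if c then 0 else f x) ≡ (if c then 0 else ∑ L f)
∑-if L true  f = ∑-zero L (λ _ → refl)
∑-if L false f = refl

∑-distrib-+ : (L : List A) (f g : A → ℕ) → ∑[ x ∈ L ] (f x + g x) ≡ ∑ L f + ∑ L g
∑-distrib-+ []       f g = refl
∑-distrib-+ (x ∷ xs) f g =
  trans (cong (f x + g x +_) (∑-distrib-+ xs f g)) (interchange (f x) (g x) (∑ xs f) (∑ xs g))

∑-distribˡ-* : (L : List A) (c : ℕ) (f : A → ℕ) → ∑[ x ∈ L ] (c * f x) ≡ c * ∑ L f
∑-distribˡ-* []       c f = sym (*-zeroʳ c)
∑-distribˡ-* (x ∷ xs) c f =
  trans (cong (c * f x +_) (∑-distribˡ-* xs c f)) (sym (*-distribˡ-+ c (f x) (∑ xs f)))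

∑-distribʳ-* : (L : List A) (c : ℕ) (f : A → ℕ) → ∑[ x ∈ L ] (f x * c) ≡ ∑ L f * c
∑-distribʳ-* L c f = trans (∑-cong L (λ x → *-comm (f x) c))
                           (trans (∑-distribˡ-* L c f) (*-comm c (∑ L f)))

∑-++ : (L M : List A) (f : A → ℕ) → ∑ (L ++ M) f ≡ ∑ L f + ∑ M f
∑-++ L M f = trans (cong sum (map-++ f L M)) (sum-++ (map f L) (map f M))

∑-map : (g : A → B) (L : List A) (f : B → ℕ) → ∑ (map g L) f ≡ ∑[ x ∈ L ] f (g x)
∑-map g L f = cong sum (sym (map-∘ L))

∑-concatMap : (g : A → List B) (L : List A) (f : B → ℕ) →
  ∑ (concatMap g L) f ≡ ∑[ x ∈ L ] ∑ (g x) f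
∑-concatMap g []       f = refl
∑-concatMap g (x ∷ xs) f =
  trans (∑-++ (g x) (concatMap g xs) f) (cong (∑ (g x) f +_) (∑-concatMap g xs f))

∑-comm : (L : List A) (M : List B) (f : A → B → ℕ) →
  ∑[ x ∈ L ] ∑[ y ∈ M ] f x y ≡ ∑[ y ∈ M ] ∑[ x ∈ L ] f x y
∑-comm []       M f = sym (∑-zero M (λ _ → refl))
∑-comm (x ∷ xs) M f =
  trans (cong (∑ M (f x) +_) (∑-comm xs M f)) (sym (∑-distrib-+ M (f x) _))

-- Without function extensionality, sums over allFuns can only be re-indexed for summands
-- that respect pointwise equality.
Extensional : ∀ {m k} → ((Fin m → Fin k) → ℕ) → Set
Extensional F = ∀ {f g} → f ≗ g → F f ≡ F g

∑-allFuns-suc : ∀ m k (F : (Fin (suc m) → Fin k) → ℕ) →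
  ∑ (allFuns (suc m) k) F ≡ ∑[ f ∈ allFuns m k ] ∑[ x ∈ allFin k ] F (x VF.∷ f)
∑-allFuns-suc m k F =
  trans (∑-concatMap _ (allFuns m k) F)
        (∑-cong (allFuns m k) (λ f → ∑-map (VF._∷ f) (allFin k) F))

∷-++ : ∀ {a b k} (x : Fin k) (f : Fin a → Fin k) (g : Fin b → Fin k) →
  (x VF.∷ f) VF.++ g ≗ x VF.∷ (f VF.++ g)
∷-++ x f g zero = refl
∷-++ {a} x f g (suc i) with splitAt a i
... | inj₁ _ = refl
... | inj₂ _ = refl

∑-allFuns-+ : ∀ a b k (F : (Fin (a + b) → Fin k) → ℕ) → Extensional F →
  ∑ (allFuns (a + b) k) F ≡ ∑[ f ∈ allFuns a k ] ∑[ g ∈ allFuns b k ] F (f VF.++ g)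
∑-allFuns-+ zero    b k F ext =
  sym (trans (+-identityʳ _) (∑-cong (allFuns b k) (λ g → ext (λ _ → refl))))
∑-allFuns-+ (suc a) b k F ext = begin
  ∑ (allFuns (suc (a + b)) k) F
    ≡⟨ ∑-allFuns-suc (a + b) k F ⟩
  ∑[ h ∈ allFuns (a + b) k ] ∑[ x ∈ allFin k ] F (x VF.∷ h)
    ≡⟨ ∑-allFuns-+ a b k _ (λ h≗h′ → ∑-cong (allFin k) (λ x → ext (∷-cong x h≗h′))) ⟩
  ∑[ f ∈ allFuns a k ] ∑[ g ∈ allFuns b k ] ∑[ x ∈ allFin k ] F (x VF.∷ (f VF.++ g))
    ≡⟨ ∑-cong (allFuns a k) (λ f → ∑-comm (allFuns b k) (allFin k) _) ⟩
  ∑[ f ∈ allFuns a k ] ∑[ x ∈ allFin k ] ∑[ g ∈ allFuns b k ] F (x VF.∷ (f VF.++ g))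
    ≡⟨ ∑-cong (allFuns a k) (λ f → ∑-cong (allFin k) (λ x →
         ∑-cong (allFuns b k) (λ g → ext (λ i → sym (∷-++ x f g i))))) ⟩
  ∑[ f ∈ allFuns a k ] ∑[ x ∈ allFin k ] ∑[ g ∈ allFuns b k ] F ((x VF.∷ f) VF.++ g)
    ≡⟨ sym (∑-allFuns-suc a k _) ⟩
  ∑[ f ∈ allFuns (suc a) k ] ∑[ g ∈ allFuns b k ] F (f VF.++ g) ∎
  where
  open ≡-Reasoning
  ∷-cong : ∀ {m} (x : Fin k) {h h′ : Fin m → Fin k} → h ≗ h′ → x VF.∷ h ≗ x VF.∷ h′
  ∷-cong x h≗h′ zero    = refl
  ∷-cong x h≗h′ (suc i) = h≗h′ i

∑-allFuns-heads : ∀ a b k (F : (Fin (suc a + suc b) → Fin k) → ℕ) → Extensional F →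
  ∑ (allFuns (suc a + suc b) k) F ≡
  ∑[ u ∈ allFin k ] ∑[ v ∈ allFin k ] ∑[ x ∈ allFuns a k ] ∑[ y ∈ allFuns b k ]
    F ((u VF.∷ x) VF.++ (v VF.∷ y))
∑-allFuns-heads a b k F ext = begin
  ∑ (allFuns (suc a + suc b) k) F
    ≡⟨ ∑-allFuns-+ (suc a) (suc b) k F ext ⟩
  ∑[ f ∈ allFuns (suc a) k ] ∑[ g ∈ allFuns (suc b) k ] F (f VF.++ g)
    ≡⟨ trans (∑-allFuns-suc a k _) (∑-cong Xs (λ x → ∑-cong Vs (λ u → ∑-allFuns-suc b k _))) ⟩
  ∑[ x ∈ Xs ] ∑[ u ∈ Vs ] ∑[ y ∈ Ys ] ∑[ v ∈ Vs ] F ((u VF.∷ x) VF.++ (v VF.∷ y))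
    ≡⟨ ∑-comm Xs Vs _ ⟩
  ∑[ u ∈ Vs ] ∑[ x ∈ Xs ] ∑[ y ∈ Ys ] ∑[ v ∈ Vs ] F ((u VF.∷ x) VF.++ (v VF.∷ y))
    ≡⟨ ∑-cong Vs (λ u → ∑-cong Xs (λ x → ∑-comm Ys Vs _)) ⟩
  ∑[ u ∈ Vs ] ∑[ x ∈ Xs ] ∑[ v ∈ Vs ] ∑[ y ∈ Ys ] F ((u VF.∷ x) VF.++ (v VF.∷ y))
    ≡⟨ ∑-cong Vs (λ u → ∑-comm Xs Vs _) ⟩
  ∑[ u ∈ Vs ] ∑[ v ∈ Vs ] ∑[ x ∈ Xs ] ∑[ y ∈ Ys ] F ((u VF.∷ x) VF.++ (v VF.∷ y)) ∎
  where
  open ≡-Reasoning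
  Vs = allFin k
  Xs = allFuns a k
  Ys = allFuns b k

∑-allFuns-1 : ∀ k (F : (Fin 1 → Fin k) → ℕ) → Extensional F →
  ∑ (allFuns 1 k) F ≡ ∑[ z ∈ allFin k ] F (const z)
∑-allFuns-1 k F ext =
  trans (∑-allFuns-suc 0 k F)
        (trans (+-identityʳ _) (∑-cong (allFin k) (λ z → ext (λ { zero → refl }))))

∑-allFuns-const-≤ : ∀ a k (F : (Fin (suc a) → Fin k) → ℕ) → Extensional F →
  ∑[ z ∈ allFin k ] F (const z) ≤ ∑ (allFuns (suc a) k) F
∑-allFuns-const-≤ zero    k F ext = ≤-reflexive (sym (∑-allFuns-1 k F ext))
∑-allFuns-const-≤ (suc a) k F ext = begin
  ∑[ z ∈ allFin k ] F (const z)
    ≡⟨ ∑-cong (allFin k) (λ z → ext (λ { zero → refl ; (suc i) → refl })) ⟩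
  ∑[ z ∈ allFin k ] F (z VF.∷ const z)
    ≤⟨ ∑-allFuns-const-≤ a k (λ f → F (f zero VF.∷ f)) ext′ ⟩
  ∑[ f ∈ allFuns (suc a) k ] F (f zero VF.∷ f)
    ≤⟨ ∑-mono (allFuns (suc a) k) (λ f → ∑-term (λ x → F (x VF.∷ f)) (∈-allFin (f zero))) ⟩
  ∑[ f ∈ allFuns (suc a) k ] ∑[ x ∈ allFin k ] F (x VF.∷ f)
    ≡⟨ sym (∑-allFuns-suc (suc a) k F) ⟩
  ∑ (allFuns (suc (suc a)) k) F ∎
  where
  open ≤-Reasoning
  ext′ : Extensional (λ f → F (f zero VF.∷ f))
  ext′ f≗g = ext (λ { zero → f≗g zero ; (suc i) → f≗g i })

∑-allFuns-allB : ∀ b k (P : Fin k → Bool) →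
  ∑[ y ∈ allFuns b k ] ⟦ allB b (P ∘ y) ⟧ ≡ (∑[ w ∈ allFin k ] ⟦ P w ⟧) ^ b
∑-allFuns-allB zero    k P = refl
∑-allFuns-allB (suc b) k P = begin
  ∑[ y ∈ allFuns (suc b) k ] ⟦ allB (suc b) (P ∘ y) ⟧
    ≡⟨ ∑-allFuns-suc b k _ ⟩
  ∑[ f ∈ allFuns b k ] ∑[ x ∈ allFin k ] ⟦ allB (suc b) (P ∘ (x VF.∷ f)) ⟧
    ≡⟨ ∑-cong (allFuns b k) (λ f → ∑-cong (allFin k) (λ x →
         trans (cong ⟦_⟧ (allB-suc b _)) (⟦∧⟧ (P x) _))) ⟩
  ∑[ f ∈ allFuns b k ] ∑[ x ∈ allFin k ] ⟦ P x ⟧ * ⟦ allB b (P ∘ f) ⟧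
    ≡⟨ ∑-cong (allFuns b k) (λ f → ∑-distribʳ-* (allFin k) _ (λ x → ⟦ P x ⟧)) ⟩
  ∑[ f ∈ allFuns b k ] s * ⟦ allB b (P ∘ f) ⟧
    ≡⟨ ∑-distribˡ-* (allFuns b k) s _ ⟩
  s * (∑[ f ∈ allFuns b k ] ⟦ allB b (P ∘ f) ⟧)
    ≡⟨ cong (s *_) (∑-allFuns-allB b k P) ⟩
  s * s ^ b ∎
  where
  open ≡-Reasoning
  s = ∑[ w ∈ allFin k ] ⟦ P w ⟧

IsHom : ∀ {m} → (Fin m → Fin m → Bool) → (G : Graph) → (Fin m → Fin (n G)) → Set
IsHom E G φ = ∀ i j → E i j ≡ true → adj G (φ i) (φ j) ≡ true

isHomB≡true⇔ : ∀ F G φ → isHomB F G φ ≡ true ⇔ IsHom (adj F) G φ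
isHomB≡true⇔ F G φ = mk⇔
  (λ h i j → to not-∨≡true⇔ (to (allB≡true⇔ _) (to (allB≡true⇔ _) h i) j))
  (λ h → from (allB≡true⇔ _) (λ i → from (allB≡true⇔ _) (λ j → from not-∨≡true⇔ (h i j))))

isHomB-cong : ∀ F G {φ ψ} → φ ≗ ψ → isHomB F G φ ≡ isHomB F G ψ
isHomB-cong F G φ≗ψ = allB-cong _ (λ i → allB-cong _ (λ j →
  cong₂ (λ s t → not (adj F i j) ∨ adj G s t) (φ≗ψ i) (φ≗ψ j)))

count≡∑ : (P : A → Bool) (L : List A) →
  length (filter (λ x → P x Data.Bool.≟ true) L) ≡ ∑[ x ∈ L ] ⟦ P x ⟧
count≡∑ P []       = refl
count≡∑ P (x ∷ xs) with P x
... | true  = cong suc (count≡∑ P xs)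
... | false = count≡∑ P xs

hom≡∑ : ∀ F G → hom F G ≡ ∑[ φ ∈ allFuns (n F) (n G) ] ⟦ isHomB F G φ ⟧
hom≡∑ F G = count≡∑ (isHomB F G) (allFuns (n F) (n G))

hom-removeEdge : ∀ F c d G → hom (removeEdge F c d) G ≡
  hom F G + (∑[ φ ∈ allFuns (n F) (n G) ] ⟦ isHomB (removeEdge F c d) G φ ∧ not (isHomB F G φ) ⟧)
hom-removeEdge F c d G = begin
  hom F⁻ G
    ≡⟨ hom≡∑ F⁻ G ⟩
  ∑[ φ ∈ Φ ] ⟦ isHomB F⁻ G φ ⟧
    ≡⟨ ∑-cong Φ (λ φ → ⟦⟧-split (isHomB F⁻ G φ) (isHomB F G φ) (hom⇒hom⁻ φ)) ⟩
  ∑[ φ ∈ Φ ] (⟦ isHomB F G φ ⟧ + ⟦ isHomB F⁻ G φ ∧ not (isHomB F G φ) ⟧)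
    ≡⟨ ∑-distrib-+ Φ _ _ ⟩
  (∑[ φ ∈ Φ ] ⟦ isHomB F G φ ⟧) + (∑[ φ ∈ Φ ] ⟦ isHomB F⁻ G φ ∧ not (isHomB F G φ) ⟧)
    ≡⟨ cong (_+ (∑[ φ ∈ Φ ] ⟦ isHomB F⁻ G φ ∧ not (isHomB F G φ) ⟧)) (sym (hom≡∑ F G)) ⟩
  hom F G + (∑[ φ ∈ Φ ] ⟦ isHomB F⁻ G φ ∧ not (isHomB F G φ) ⟧) ∎
  where
  open ≡-Reasoning
  F⁻ = removeEdge F c d
  Φ = allFuns (n F) (n G)
  hom⇒hom⁻ : ∀ φ → isHomB F G φ ≡ true → isHomB F⁻ G φ ≡ true
  hom⇒hom⁻ φ h = from (isHomB≡true⇔ F⁻ G φ)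
    (λ i j e → to (isHomB≡true⇔ F G φ) h i j (proj₁ (to ∧≡true⇔ e)))
  ⟦⟧-split : ∀ s t → (t ≡ true → s ≡ true) → ⟦ s ⟧ ≡ ⟦ t ⟧ + ⟦ s ∧ not t ⟧
  ⟦⟧-split false false _ = refl
  ⟦⟧-split false true  h = contradiction (h refl) (λ ())
  ⟦⟧-split true  false _ = refl
  ⟦⟧-split true  true  _ = refl

data Side (p q : ℕ) : Fin (p + q) → Set where
  left  : (i : Fin p) → Side p q (i ↑ˡ q)
  right : (j : Fin q) → Side p q (p ↑ʳ j)

side : ∀ p q (k : Fin (p + q)) → Side p q k
side p q k = subst (Side p q) (join-splitAt p q k) (fromSum (splitAt p k))
  where
  fromSum : (s : Fin p ⊎ Fin q) → Side p q (join p q s)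
  fromSum (inj₁ i) = left i
  fromSum (inj₂ j) = right j

toℕ<ᵇn : ∀ {m} (i : Fin m) → (toℕ i <ᵇ m) ≡ true
toℕ<ᵇn i = to T-≡ (<⇒<ᵇ (toℕ<n i))

toℕ≡ᵇn : ∀ {m} (i : Fin m) → (toℕ i ≡ᵇ m) ≡ false
toℕ≡ᵇn zero    = refl
toℕ≡ᵇn (suc i) = toℕ≡ᵇn i

m+n<ᵇm : ∀ m k → (m + k <ᵇ m) ≡ false
m+n<ᵇm zero    k = refl
m+n<ᵇm (suc m) k = m+n<ᵇm m k

m+n≡ᵇm : ∀ m k → (m + k ≡ᵇ m) ≡ (k ≡ᵇ 0)
m+n≡ᵇm zero    k = refl
m+n≡ᵇm (suc m) k = m+n≡ᵇm m k

module _ (p q : ℕ) where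

  ↑ˡ<ᵇ : (i : Fin p) → (toℕ (i ↑ˡ q) <ᵇ p) ≡ true
  ↑ˡ<ᵇ i = trans (cong (_<ᵇ p) (toℕ-↑ˡ i q)) (toℕ<ᵇn i)

  ↑ʳ<ᵇ : (j : Fin q) → (toℕ (p ↑ʳ j) <ᵇ p) ≡ false
  ↑ʳ<ᵇ j = trans (cong (_<ᵇ p) (toℕ-↑ʳ p j)) (m+n<ᵇm p (toℕ j))

  KAdj-↑ˡ-↑ʳ : (i : Fin p) (j : Fin q) → KAdj p q (i ↑ˡ q) (p ↑ʳ j) ≡ true
  KAdj-↑ˡ-↑ʳ i j = cong₂ _xor_ (↑ˡ<ᵇ i) (↑ʳ<ᵇ j)

  KAdj-↑ˡ-↑ˡ : (i i′ : Fin p) → KAdj p q (i ↑ˡ q) (i′ ↑ˡ q) ≡ false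
  KAdj-↑ˡ-↑ˡ i i′ = cong₂ _xor_ (↑ˡ<ᵇ i) (↑ˡ<ᵇ i′)

  KAdj-↑ʳ-↑ʳ : (j j′ : Fin q) → KAdj p q (p ↑ʳ j) (p ↑ʳ j′) ≡ false
  KAdj-↑ʳ-↑ʳ j j′ = cong₂ _xor_ (↑ʳ<ᵇ j) (↑ʳ<ᵇ j′)

  Kminus-↑ˡ-↑ʳ : (i : Fin p) (j : Fin q) →
    adj (Kminus p q) (i ↑ˡ q) (p ↑ʳ j) ≡ not ((toℕ i ≡ᵇ 0) ∧ (toℕ j ≡ᵇ 0))
  Kminus-↑ˡ-↑ʳ i j = cong₂ (λ s t → s ∧ not t) (KAdj-↑ˡ-↑ʳ i j) isPair-↑ˡ-↑ʳ
    where
    isPair-↑ˡ-↑ʳ : isPair 0 p (i ↑ˡ q) (p ↑ʳ j) ≡ ((toℕ i ≡ᵇ 0) ∧ (toℕ j ≡ᵇ 0))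
    isPair-↑ˡ-↑ʳ rewrite toℕ-↑ˡ i q | toℕ-↑ʳ p j | m+n≡ᵇm p (toℕ j) | toℕ≡ᵇn i =
      ∨-identityʳ _

module _ {p q : ℕ} (E : Fin (p + q) → Fin (p + q) → Bool) (E-sym : ∀ i j → E i j ≡ E j i)
         (E⊆K : ∀ i j → E i j ≡ true → KAdj p q i j ≡ true) (G : Graph) where

  IsHom-++⇔ : ∀ {f : Fin p → Fin (n G)} {g : Fin q → Fin (n G)} →
    IsHom E G (f VF.++ g) ⇔ (∀ i j → E (i ↑ˡ q) (p ↑ʳ j) ≡ true → adj G (f i) (g j) ≡ true)
  IsHom-++⇔ {f} {g} = mk⇔ across fromAcross
    where
    Edge : Fin (n G) → Fin (n G) → Set
    Edge s t = adj G s t ≡ true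

    across : IsHom E G (f VF.++ g) → ∀ i j → E (i ↑ˡ q) (p ↑ʳ j) ≡ true → Edge (f i) (g j)
    across h i j e = subst₂ Edge (lookup-++ˡ f g i) (lookup-++ʳ f g j) (h _ _ e)

    fromAcross : (∀ i j → E (i ↑ˡ q) (p ↑ʳ j) ≡ true → Edge (f i) (g j)) → IsHom E G (f VF.++ g)
    fromAcross h k l e with side p q k | side p q l
    ... | left i  | left i′  = contradiction (trans (sym (KAdj-↑ˡ-↑ˡ p q i i′)) (E⊆K _ _ e)) (λ ())
    ... | right j | right j′ = contradiction (trans (sym (KAdj-↑ʳ-↑ʳ p q j j′)) (E⊆K _ _ e)) (λ ())
    ... | left i  | right j  =
      subst₂ Edge (sym (lookup-++ˡ f g i)) (sym (lookup-++ʳ f g j)) (h i j e)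
    ... | right j | left i   =
      subst₂ Edge (sym (lookup-++ʳ f g j)) (sym (lookup-++ˡ f g i))
        (trans (Graph.sym G _ _) (h i j (trans (E-sym _ _) e)))

-- Sums over non-adjacent pairs, and biclique counts

module _ (G : Graph) where
  private
    Vs = allFin (n G)

  -- The diagonal u = v is included, as in η.
  nonEdgeSum : (Fin (n G) → Fin (n G) → ℕ) → ℕ
  nonEdgeSum X = ∑[ u ∈ Vs ] ∑[ v ∈ Vs ] (if adj G u v then 0 else X u v)

  nonEdgeSum-cong : ∀ {X Y} → (∀ u v → X u v ≡ Y u v) → nonEdgeSum X ≡ nonEdgeSum Y
  nonEdgeSum-cong X≡Y = ∑-cong Vs λ u → ∑-cong Vs λ v → cong (if adj G u v then 0 else_) (X≡Y u v)

  nonEdgeSum-mono : ∀ {X Y} → (∀ u v → X u v ≤ Y u v) → nonEdgeSum X ≤ nonEdgeSum Y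
  nonEdgeSum-mono X≤Y = ∑-mono Vs λ u → ∑-mono Vs λ v → if-mono (adj G u v) (X≤Y u v)
    where
    if-mono : ∀ {s t} c → s ≤ t → (if c then 0 else s) ≤ (if c then 0 else t)
    if-mono true  _   = z≤n
    if-mono false s≤t = s≤t

  nonEdgeSum-flip : ∀ X → nonEdgeSum (λ u v → X v u) ≡ nonEdgeSum X
  nonEdgeSum-flip X = trans (∑-comm Vs Vs _)
    (∑-cong Vs λ v → ∑-cong Vs λ u → cong (if_then 0 else X v u) (Graph.sym G u v))

  nonEdgeSum-zero : ∀ {X} → (∀ u v → adj G u v ≡ false → X u v ≡ 0) → nonEdgeSum X ≡ 0
  nonEdgeSum-zero {X} X≡0 = ∑-zero Vs λ u → ∑-zero Vs λ v → term u v
    where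
    term : ∀ u v → (if adj G u v then 0 else X u v) ≡ 0
    term u v with adj G u v in eq
    ... | true  = refl
    ... | false = X≡0 u v eq

  nonEdgeSum-term : ∀ X {u v} → adj G u v ≡ false → X u v ≤ nonEdgeSum X
  nonEdgeSum-term X {u} {v} u≁v = begin
    X u v
      ≡⟨ cong (if_then 0 else X u v) (sym u≁v) ⟩
    (if adj G u v then 0 else X u v)
      ≤⟨ ∑-term (λ v → if adj G u v then 0 else X u v) (∈-allFin v) ⟩
    ∑[ v ∈ Vs ] (if adj G u v then 0 else X u v)
      ≤⟨ ∑-term (λ u → ∑[ v ∈ Vs ] (if adj G u v then 0 else X u v)) (∈-allFin u) ⟩
    nonEdgeSum X ∎
    where open ≤-Reasoning

module _ (G : Graph) where
  private
    V = Fin (n G)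
    Vs = allFin (n G)

  Biclique : ∀ {a b} → (R S : V → Bool) → (Fin a → V) → (Fin b → V) → Set
  Biclique R S x y =
    (∀ i → R (x i) ≡ true) × (∀ j → S (y j) ≡ true) × (∀ i j → adj G (x i) (y j) ≡ true)

  commonNbrB : ∀ {a} → (V → Bool) → (Fin a → V) → V → Bool
  commonNbrB {a} S x w = S w ∧ allB a (λ i → adj G (x i) w)

  isBicliqueB : ∀ {a b} → (R S : V → Bool) → (Fin a → V) → (Fin b → V) → Bool
  isBicliqueB {a} {b} R S x y = allB a (R ∘ x) ∧ allB b (commonNbrB S x ∘ y)

  isBicliqueB≡true⇔ : ∀ {a b} R S {x : Fin a → V} {y : Fin b → V} →
    isBicliqueB R S x y ≡ true ⇔ Biclique R S x y
  isBicliqueB≡true⇔ {a} {b} R S = mk⇔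
    (λ h → let (hR , hC) = to ∧≡true⇔ h
               hC′ j = to ∧≡true⇔ (to (allB≡true⇔ b) hC j) in
           to (allB≡true⇔ a) hR , proj₁ ∘ hC′ , (λ i j → to (allB≡true⇔ a) (proj₂ (hC′ j)) i))
    (λ { (hR , hS , hE) → from ∧≡true⇔
           (from (allB≡true⇔ a) hR ,
            from (allB≡true⇔ b) (λ j → from ∧≡true⇔ (hS j , from (allB≡true⇔ a) (λ i → hE i j)))) })

  isBicliqueB-comm : ∀ {a b} R S (x : Fin a → V) (y : Fin b → V) →
    isBicliqueB R S x y ≡ isBicliqueB S R y x
  isBicliqueB-comm R S x y =
    ⇔→≡ (⇔-trans (isBicliqueB≡true⇔ R S {x} {y})
          (⇔-trans (mk⇔ (swap {R = R} {S}) (swap {R = S} {R}))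
                   (⇔-sym (isBicliqueB≡true⇔ S R {y} {x}))))
    where
    swap : ∀ {a b R S} {x : Fin a → V} {y : Fin b → V} →
      Biclique R S x y → Biclique S R y x
    swap (hR , hS , hE) = hS , hR , (λ j i → trans (Graph.sym G _ _) (hE i j))

  bicliques : ℕ → ℕ → (R S : V → Bool) → ℕ
  bicliques a b R S =
    ∑[ x ∈ allFuns a (n G) ] ∑[ y ∈ allFuns b (n G) ] ⟦ isBicliqueB R S x y ⟧

  stars : ℕ → (R S : V → Bool) → ℕ
  stars b R S = ∑[ z ∈ Vs ] ⟦ R z ⟧ * (∑[ w ∈ Vs ] ⟦ S w ∧ adj G z w ⟧) ^ b

  bicliques-comm : ∀ a b R S → bicliques a b R S ≡ bicliques b a S R
  bicliques-comm a b R S =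
    trans (∑-cong (allFuns a (n G)) λ x → ∑-cong (allFuns b (n G)) λ y →
             cong ⟦_⟧ (isBicliqueB-comm R S x y))
          (∑-comm (allFuns a (n G)) (allFuns b (n G)) _)

  completions : ∀ {a} b (R S : V → Bool) → (Fin a → V) → ℕ
  completions {a} b R S x = ⟦ allB a (R ∘ x) ⟧ * (∑[ w ∈ Vs ] ⟦ commonNbrB S x w ⟧) ^ b

  bicliques≡∑completions : ∀ a b R S →
    bicliques a b R S ≡ ∑[ x ∈ allFuns a (n G) ] completions b R S x
  bicliques≡∑completions a b R S = ∑-cong (allFuns a (n G)) λ x →
    trans (∑-cong (allFuns b (n G)) (λ y → ⟦∧⟧ (allB a (R ∘ x)) _))
          (trans (∑-distribˡ-* (allFuns b (n G)) ⟦ allB a (R ∘ x) ⟧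
                                (λ y → ⟦ allB b (commonNbrB S x ∘ y) ⟧))
                 (cong (⟦ allB a (R ∘ x) ⟧ *_) (∑-allFuns-allB b (n G) (commonNbrB S x))))

  completions-cong : ∀ {a} b R S → Extensional (completions {a} b R S)
  completions-cong {a} b R S x≗x′ = cong₂ (λ s t → ⟦ s ⟧ * t ^ b)
    (allB-cong a (cong R ∘ x≗x′))
    (∑-cong (Vs) (λ w → cong (λ t → ⟦ S w ∧ t ⟧)
      (allB-cong a (λ i → cong (λ z → adj G z w) (x≗x′ i)))))

  completions-const : ∀ a b R S z →
    completions {suc a} b R S (const z) ≡ ⟦ R z ⟧ * (∑[ w ∈ Vs ] ⟦ S w ∧ adj G z w ⟧) ^ b
  completions-const a b R S z = cong₂ (λ s t → ⟦ s ⟧ * t ^ b)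
    (allB-const a (R z))
    (∑-cong (Vs) (λ w → cong (λ t → ⟦ S w ∧ t ⟧) (allB-const a (adj G z w))))

  stars≤bicliques : ∀ a b R S → stars b R S ≤ bicliques (suc a) b R S
  stars≤bicliques a b R S = begin
    stars b R S
      ≡⟨ ∑-cong (Vs) (λ z → sym (completions-const a b R S z)) ⟩
    ∑[ z ∈ Vs ] completions {suc a} b R S (const z)
      ≤⟨ ∑-allFuns-const-≤ a (n G) _ (completions-cong b R S) ⟩
    ∑[ x ∈ allFuns (suc a) (n G) ] completions b R S x
      ≡⟨ sym (bicliques≡∑completions (suc a) b R S) ⟩
    bicliques (suc a) b R S ∎
    where open ≤-Reasoning

  bicliques-1 : ∀ b R S → bicliques 1 b R S ≡ stars b R S
  bicliques-1 b R S = begin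
    bicliques 1 b R S
      ≡⟨ bicliques≡∑completions 1 b R S ⟩
    ∑[ x ∈ allFuns 1 (n G) ] completions b R S x
      ≡⟨ ∑-allFuns-1 (n G) _ (completions-cong b R S) ⟩
    ∑[ z ∈ Vs ] completions {1} b R S (const z)
      ≡⟨ ∑-cong (Vs) (completions-const 0 b R S) ⟩
    stars b R S ∎
    where open ≡-Reasoning

  bicliques≡0 : ∀ a b R S → (∀ x y → ¬ Biclique R S x y) → bicliques a b R S ≡ 0
  bicliques≡0 a b R S none = ∑-zero (allFuns a (n G)) λ x → ∑-zero (allFuns b (n G)) λ y →
    ⟦⟧≡0 (none x y ∘ to (isBicliqueB≡true⇔ R S))

  biclique⇒InD : ∀ {a b u v} {x : Fin (suc a) → V} {y : Fin (suc b) → V} →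
    adj G u v ≡ false → Biclique (adj G v) (adj G u) x y → InD G u v
  biclique⇒InD {u = u} {v} {x} {y} u≁v (hR , hS , hE) = u≁v , y zero , hS zero , m<n⇒n≢0 codeg>0
    where
    codeg>0 : 0 < codeg G v (y zero)
    codeg>0 = subst (λ t → ⟦ t ⟧ ≤ codeg G v (y zero))
                    (cong₂ _∧_ (hR zero) (trans (Graph.sym G _ _) (hE zero zero)))
                    (∑-term (λ z → ⟦ adj G v z ∧ adj G (y zero) z ⟧) (∈-allFin (x zero)))

-- Comparing hom(F, G) with hom(K_{p,q}, G)

module _ {a b : ℕ} (G : Graph) (u v : Fin (n G)) (x : Fin a → Fin (n G)) (y : Fin b → Fin (n G))
  where
  private
    p = suc a
    q = suc b

    Edge : Fin (n G) → Fin (n G) → Set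
    Edge s t = adj G s t ≡ true

    Across : (Fin (p + q) → Fin (p + q) → Bool) → Set
    Across E = ∀ i j → E (i ↑ˡ q) (p ↑ʳ j) ≡ true → Edge ((u VF.∷ x) i) ((v VF.∷ y) j)

    Bic = Biclique G (adj G v) (adj G u) x y
    bic = isBicliqueB G (adj G v) (adj G u) x y
    bic⇔ = isBicliqueB≡true⇔ G (adj G v) (adj G u) {x} {y}

    Kminus-across⇔ : Across (adj (Kminus p q)) ⇔ Bic
    Kminus-across⇔ = mk⇔
      (λ h → (λ i → trans (Graph.sym G _ _) (h (suc i) zero (Kminus-↑ˡ-↑ʳ p q (suc i) zero))) ,
             (λ j → h zero (suc j) (Kminus-↑ˡ-↑ʳ p q zero (suc j))) ,
             (λ i j → h (suc i) (suc j) (Kminus-↑ˡ-↑ʳ p q (suc i) (suc j))))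
      cells
      where
      cells : Bic → Across (adj (Kminus p q))
      cells _            zero    zero    e =
        contradiction (trans (sym (Kminus-↑ˡ-↑ʳ p q zero zero)) e) (λ ())
      cells (_ , hS , _) zero    (suc j) _ = hS j
      cells (hR , _ , _) (suc i) zero    _ = trans (Graph.sym G _ _) (hR i)
      cells (_ , _ , hE) (suc i) (suc j) _ = hE i j

    K-across⇔ : Across (KAdj p q) ⇔ (adj G u v ≡ true × bic ≡ true)
    K-across⇔ = mk⇔
      (λ h → h zero zero (KAdj-↑ˡ-↑ʳ p q zero zero) ,
             from bic⇔ (to Kminus-across⇔ (λ i j _ → h i j (KAdj-↑ˡ-↑ʳ p q i j))))
      (λ (u~v , hB) → cells u~v (to bic⇔ hB))
      where
      cells : Edge u v → Bic → Across (KAdj p q)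
      cells u~v _            zero    zero    _ = u~v
      cells _   (_ , hS , _) zero    (suc j) _ = hS j
      cells _   (hR , _ , _) (suc i) zero    _ = trans (Graph.sym G _ _) (hR i)
      cells _   (_ , _ , hE) (suc i) (suc j) _ = hE i j

  isHomB-Kminus-heads : isHomB (Kminus (suc a) (suc b)) G ((u VF.∷ x) VF.++ (v VF.∷ y)) ≡
                        isBicliqueB G (adj G v) (adj G u) x y
  isHomB-Kminus-heads = ⇔→≡ (⇔-trans (isHomB≡true⇔ (Kminus p q) G _)
    (⇔-trans (IsHom-++⇔ (adj (Kminus p q)) (Graph.sym (Kminus p q)) (λ _ _ → proj₁ ∘ to ∧≡true⇔) G)
    (⇔-trans Kminus-across⇔ (⇔-sym bic⇔))))

  isHomB-K-heads : isHomB (K (suc a) (suc b)) G ((u VF.∷ x) VF.++ (v VF.∷ y)) ≡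
                   adj G u v ∧ isBicliqueB G (adj G v) (adj G u) x y
  isHomB-K-heads = ⇔→≡ (⇔-trans (isHomB≡true⇔ (K p q) G _)
    (⇔-trans (IsHom-++⇔ (KAdj p q) (Graph.sym (K p q)) (λ _ _ e → e) G)
    (⇔-trans K-across⇔ (⇔-sym ∧≡true⇔))))

nonEdgeBicliques : ℕ → ℕ → Graph → ℕ
nonEdgeBicliques a b G = nonEdgeSum G (λ u v → bicliques G a b (adj G v) (adj G u))

hom-Kminus : ∀ a b G →
  hom (Kminus (suc a) (suc b)) G ≡ hom (K (suc a) (suc b)) G + nonEdgeBicliques a b G
hom-Kminus a b G = trans (hom-removeEdge (K p q) 0 p G) (cong (hom (K p q) G +_) (begin
  ∑[ φ ∈ allFuns (p + q) (n G) ] extra φ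
    ≡⟨ ∑-allFuns-heads a b (n G) extra extra-cong ⟩
  ∑[ u ∈ Vs ] ∑[ v ∈ Vs ] ∑[ x ∈ Xs ] ∑[ y ∈ Ys ] extra ((u VF.∷ x) VF.++ (v VF.∷ y))
    ≡⟨ ∑-cong Vs (λ u → ∑-cong Vs (λ v → ∑-cong Xs (λ x → ∑-cong Ys (λ y → extra-heads u v x y)))) ⟩
  ∑[ u ∈ Vs ] ∑[ v ∈ Vs ] ∑[ x ∈ Xs ] ∑[ y ∈ Ys ] (if adj G u v then 0 else ⟦ bic u v x y ⟧)
    ≡⟨ ∑-cong Vs (λ u → ∑-cong Vs (λ v →
         trans (∑-cong Xs (λ x → ∑-if Ys (adj G u v) _)) (∑-if Xs (adj G u v) _))) ⟩
  nonEdgeBicliques a b G ∎))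
  where
  open ≡-Reasoning
  p = suc a
  q = suc b
  Vs = allFin (n G)
  Xs = allFuns a (n G)
  Ys = allFuns b (n G)

  extra : (Fin (p + q) → Fin (n G)) → ℕ
  extra φ = ⟦ isHomB (Kminus p q) G φ ∧ not (isHomB (K p q) G φ) ⟧

  extra-cong : Extensional extra
  extra-cong φ≗ψ =
    cong₂ (λ s t → ⟦ s ∧ not t ⟧) (isHomB-cong (Kminus p q) G φ≗ψ) (isHomB-cong (K p q) G φ≗ψ)

  bic : Fin (n G) → Fin (n G) → (Fin a → Fin (n G)) → (Fin b → Fin (n G)) → Bool
  bic u v = isBicliqueB G (adj G v) (adj G u)

  extra-heads : ∀ u v x y →
    extra ((u VF.∷ x) VF.++ (v VF.∷ y)) ≡ (if adj G u v then 0 else ⟦ bic u v x y ⟧)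
  extra-heads u v x y =
    trans (cong₂ (λ s t → ⟦ s ∧ not t ⟧) (isHomB-Kminus-heads G u v x y) (isHomB-K-heads G u v x y))
          (⟦⟧-extra (adj G u v) (bic u v x y))
    where
    ⟦⟧-extra : ∀ c s → ⟦ s ∧ not (c ∧ s) ⟧ ≡ (if c then 0 else ⟦ s ⟧)
    ⟦⟧-extra true  true  = refl
    ⟦⟧-extra true  false = refl
    ⟦⟧-extra false true  = refl
    ⟦⟧-extra false false = refl

noD⇒nonEdgeBicliques≡0 : ∀ a b G → (∀ u v → ¬ InD G u v) → nonEdgeBicliques (suc a) (suc b) G ≡ 0
noD⇒nonEdgeBicliques≡0 a b G noD = nonEdgeSum-zero G λ u v u≁v →
  bicliques≡0 G (suc a) (suc b) (adj G v) (adj G u) (λ x y → noD u v ∘ biclique⇒InD G u≁v)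

-- The summand of η at (u, v, w) is guardedPower e (adj G u w) (codeg G v w): the guard encodes
-- the condition N(v) ∩ N(w) ≠ ∅ on the inner sum.
guardedPower : ℕ → Bool → ℕ → ℕ
guardedPower e c d = if c ∧ not (d ≡ᵇ 0) then d ^ e else 0

guardedPower-pos : ∀ e {c d} → c ≡ true → d ≢ 0 → 0 < guardedPower e c d
guardedPower-pos e {d = zero}  refl d≢0 = contradiction refl d≢0
guardedPower-pos e {d = suc d} refl _   = m^n>0 (suc d) e

guardedPower-zero : ∀ e {c d} → (c ≡ true → d ≢ 0 → ⊥) → guardedPower e c d ≡ 0
guardedPower-zero e {false}        _ = refl
guardedPower-zero e {true} {zero}  _ = refl
guardedPower-zero e {true} {suc d} h = contradiction (λ ()) (h refl)

guardedPower-suc : ∀ e c d → guardedPower (suc e) c d ≡ ⟦ c ⟧ * d ^ suc e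
guardedPower-suc e false d       = refl
guardedPower-suc e true  zero    = refl
guardedPower-suc e true  (suc d) = sym (*-identityˡ _)

eta≡0⇔noD : ∀ p q G → eta p q G ≡ 0 ⇔ (∀ u v → ¬ InD G u v)
eta≡0⇔noD p q G = mk⇔
  (λ η≡0 u v d → n>0⇒n≢0 (InD⇒η>0 d) η≡0)
  (λ noD → nonEdgeSum-zero G λ u v u≁v → ∑-zero (allFin (n G)) λ w →
     guardedPower-zero e (λ u~w codeg≢0 → noD u v (u≁v , w , u~w , codeg≢0)))
  where
  e = (p ⊔ q) ∸ 1

  ηTerm : Fin (n G) → Fin (n G) → ℕ
  ηTerm u v = ∑[ w ∈ allFin (n G) ] guardedPower e (adj G u w) (codeg G v w)

  InD⇒η>0 : ∀ {u v} → InD G u v → 0 < eta p q G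
  InD⇒η>0 {u} {v} (u≁v , w , u~w , codeg≢0) = begin-strict
    0
      <⟨ guardedPower-pos e u~w codeg≢0 ⟩
    guardedPower e (adj G u w) (codeg G v w)
      ≤⟨ ∑-term (λ w → guardedPower e (adj G u w) (codeg G v w)) (∈-allFin w) ⟩
    ηTerm u v
      ≤⟨ nonEdgeSum-term G ηTerm u≁v ⟩
    eta p q G ∎
    where open ≤-Reasoning

eta≡nonEdgeSum-stars : ∀ a b G →
  eta (suc (suc a)) (suc (suc b)) G ≡
  nonEdgeSum G (λ u v → stars G (suc (a ⊔ b)) (adj G u) (adj G v))
eta≡nonEdgeSum-stars a b G = nonEdgeSum-cong G λ u v → ∑-cong (allFin (n G)) λ w →
  guardedPower-suc (a ⊔ b) (adj G u w) (codeg G v w)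

eta≤nonEdgeBicliques : ∀ a b G →
  eta (suc (suc a)) (suc (suc b)) G ≤ nonEdgeBicliques (suc a) (suc b) G
eta≤nonEdgeBicliques a b G with ≤-total b a
... | inj₁ b≤a rewrite eta≡nonEdgeSum-stars a b G | m≥n⇒m⊔n≡m b≤a = nonEdgeSum-mono G λ u v →
  ≤-trans (stars≤bicliques G b (suc a) (adj G u) (adj G v))
          (≤-reflexive (bicliques-comm G (suc b) (suc a) (adj G u) (adj G v)))
... | inj₂ a≤b rewrite eta≡nonEdgeSum-stars a b G | m≤n⇒m⊔n≡n a≤b =
  ≤-trans (≤-reflexive (sym (nonEdgeSum-flip G _)))
          (nonEdgeSum-mono G λ u v → stars≤bicliques G a (suc b) (adj G v) (adj G u))

eta≡nonEdgeBicliques : ∀ a b G → a ≡ 0 ⊎ b ≡ 0 →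
  eta (suc (suc a)) (suc (suc b)) G ≡ nonEdgeBicliques (suc a) (suc b) G
eta≡nonEdgeBicliques zero b G _ = begin
  eta 2 (suc (suc b)) G
    ≡⟨ eta≡nonEdgeSum-stars 0 b G ⟩
  nonEdgeSum G (λ u v → stars G (suc b) (adj G u) (adj G v))
    ≡⟨ sym (nonEdgeSum-flip G _) ⟩
  nonEdgeSum G (λ u v → stars G (suc b) (adj G v) (adj G u))
    ≡⟨ nonEdgeSum-cong G (λ u v → sym (bicliques-1 G (suc b) (adj G v) (adj G u))) ⟩
  nonEdgeBicliques 1 (suc b) G ∎
  where open ≡-Reasoning
eta≡nonEdgeBicliques (suc a) zero G _ = begin
  eta (suc (suc (suc a))) 2 G
    ≡⟨ eta≡nonEdgeSum-stars (suc a) 0 G ⟩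
  nonEdgeSum G (λ u v → stars G (suc (suc a)) (adj G u) (adj G v))
    ≡⟨ nonEdgeSum-cong G (λ u v → sym (bicliques-1 G (suc (suc a)) (adj G u) (adj G v))) ⟩
  nonEdgeSum G (λ u v → bicliques G 1 (suc (suc a)) (adj G u) (adj G v))
    ≡⟨ nonEdgeSum-cong G (λ u v → bicliques-comm G 1 (suc (suc a)) (adj G u) (adj G v)) ⟩
  nonEdgeBicliques (suc (suc a)) 1 G ∎
  where open ≡-Reasoning
eta≡nonEdgeBicliques (suc a) (suc b) G (inj₁ ())
eta≡nonEdgeBicliques (suc a) (suc b) G (inj₂ ())

lemma3 : (p q : ℕ) → p ≥ 2 → q ≥ 2 → (G : Graph) → Bipartite G →
    (hom (Kminus p q) G ≥ hom (K p q) G + eta p q G)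
    × (hom (K p q) G + eta p q G ≥ hom (K p q) G)
    × (hom (Kminus p q) G ≡ hom (K p q) G ⇔ eta p q G ≡ 0)
    × (eta p q G ≡ 0 ⇔ (∀ u v → ¬ InD G u v))
    × (p ≡ 2 ⊎ q ≡ 2 → hom (Kminus p q) G ≡ hom (K p q) G + eta p q G)
lemma3 p@(suc (suc a)) q@(suc (suc b)) (s≤s (s≤s z≤n)) (s≤s (s≤s z≤n)) G _ =
  lower-bound , m≤m+n _ _ , mk⇔ hom≡⇒η≡0 η≡0⇒hom≡ , eta≡0⇔noD p q G , equality
  where
  extra = nonEdgeBicliques (suc a) (suc b) G

  split : hom (Kminus p q) G ≡ hom (K p q) G + extra
  split = hom-Kminus (suc a) (suc b) G

  lower-bound : hom (Kminus p q) G ≥ hom (K p q) G + eta p q G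
  lower-bound =
    ≤-trans (+-monoʳ-≤ (hom (K p q) G) (eta≤nonEdgeBicliques a b G)) (≤-reflexive (sym split))

  hom≡⇒η≡0 : hom (Kminus p q) G ≡ hom (K p q) G → eta p q G ≡ 0
  hom≡⇒η≡0 e = n≤0⇒n≡0 (≤-trans (eta≤nonEdgeBicliques a b G) (≤-reflexive
    (+-cancelˡ-≡ (hom (K p q) G) extra 0 (trans (sym split) (trans e (sym (+-identityʳ _)))))))

  η≡0⇒hom≡ : eta p q G ≡ 0 → hom (Kminus p q) G ≡ hom (K p q) G
  η≡0⇒hom≡ η≡0 = trans split (trans (cong (hom (K p q) G +_)
    (noD⇒nonEdgeBicliques≡0 a b G (to (eta≡0⇔noD p q G) η≡0))) (+-identityʳ _))

  equality : p ≡ 2 ⊎ q ≡ 2 → hom (Kminus p q) G ≡ hom (K p q) G + eta p q G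
  equality p≡2⊎q≡2 = trans split (cong (hom (K p q) G +_) (sym (eta≡nonEdgeBicliques a b G
    (Data.Sum.map 2+a≡2⇒a≡0 2+a≡2⇒a≡0 p≡2⊎q≡2))))
    where
    2+a≡2⇒a≡0 : ∀ {a} → suc (suc a) ≡ 2 → a ≡ 0
    2+a≡2⇒a≡0 = suc-injective ∘ suc-injective
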